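{- Let $G=G(P,H)$ be a point-halfspace incidence graph in $\mathbb{R}^d$. Then there is a partition $H=\bigcup_{i=1}^{2^d}H_i$ such that each $G(P,H_i)$ is a positive point-halfspace incidence graph.
   Context: A halfspace in $\mathbb{R}^d$ is a set $h=\{x\in\mathbb{R}^d:\langle w_h,x\rangle\le t_h\}$ with $w_h\neq0$; $w_h$ is its normal vector. For a set $P$ of points and a set $H$ of halfspaces in $\mathbb{R}^d$, $G(P,H)$ is the bipartite graph with parts $P,H$ and edges $ph$ for $p\in h$. A bipartite graph is a positive point-halfspace incidence graph in $\mathbb{R}^d$ if it is isomorphic to some $G(P,H)$ (points to points, halfspaces to halfspaces) in which, in addition, the normal vectors of all halfspaces in $H$ have pairwise non-negative dot products. -}

module Defs where

open import Level using (Level; _⊔_; suc)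
open import Data.Nat using (ℕ; zero) renaming (suc to sucℕ)
open import Data.Fin using (Fin) renaming (zero to fz; suc to fs)
open import Data.Product using (Σ; ∃; _×_; _,_)
open import Function.Bundles using (_⇔_)
open import Relation.Nullary using (¬_)
open import Relation.Binary.PropositionalEquality using (_≡_)
open import Relation.Binary.Structures using (IsTotalOrder)
open import Algebra.Bundles using (CommutativeRing)

-- An ordered field (ℝ is the intended instance). The statement is proved
-- for every ordered field, in particular for ℝ.
record OrderedField (c ℓ₁ ℓ₂ : Level) : Set (suc (c ⊔ ℓ₁ ⊔ ℓ₂)) where
  field
    commutativeRing : CommutativeRing c ℓ₁
  open CommutativeRing commutativeRing public
  field
    _≤_         : Carrier → Carrier → Set ℓ₂
    isTotalOrder : IsTotalOrder _≈_ _≤_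
    +-mono-≤    : ∀ {x y} z → x ≤ y → (x + z) ≤ (y + z)
    *-nonneg    : ∀ {x y} → 0# ≤ x → 0# ≤ y → 0# ≤ (x * y)
    0≉1         : ¬ (0# ≈ 1#)
    inverse     : ∀ x → ¬ (x ≈ 0#) → ∃ λ y → (x * y) ≈ 1#

module Geometry {c ℓ₁ ℓ₂ : Level} (F : OrderedField c ℓ₁ ℓ₂) where
  open OrderedField F

  Point : ℕ → Set c
  Point d = Fin d → Carrier

  _≈ᵖ_ : ∀ {d} → Point d → Point d → Set ℓ₁
  x ≈ᵖ y = ∀ k → x k ≈ y k

  dot : ∀ {d} → Point d → Point d → Carrier
  dot {zero}   x y = 0#
  dot {sucℕ d} x y = (x fz * y fz) + dot {d} (λ k → x (fs k)) (λ k → y (fs k))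

  record Halfspace (d : ℕ) : Set (c ⊔ ℓ₁) where
    field
      normal    : Point d
      threshold : Carrier
      normal≠0  : ¬ (normal ≈ᵖ (λ _ → 0#))
  open Halfspace public

  _∈ₕ_ : ∀ {d} → Point d → Halfspace d → Set ℓ₂
  x ∈ₕ h = dot (normal h) x ≤ threshold h

  SameSet : ∀ {d} → Halfspace d → Halfspace d → Set (c ⊔ ℓ₂)
  SameSet h h' = ∀ x → (x ∈ₕ h) ⇔ (x ∈ₕ h')

  -- A bipartite graph with parts L (points side) and R (halfspaces side)
  -- and edge relation E is a positive point-halfspace incidence graph in
  -- F^d iff it is isomorphic to some G(P',H') with pairwise non-negative
  -- normal dot products; i.e. there are injective labellings of L by
  -- points and of R by halfspaces (distinct as sets) such that
  -- E l r  ⇔  p l ∈ h r.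
  IsPositiveIncidenceGraph : (d : ℕ) {a b e : Level} (L : Set a) (R : Set b)
    (E : L → R → Set e) → Set (c ⊔ ℓ₁ ⊔ ℓ₂ ⊔ a ⊔ b ⊔ e)
  IsPositiveIncidenceGraph d L R E =
    Σ (L → Point d) λ p → Σ (R → Halfspace d) λ h →
      (∀ l l' → p l ≈ᵖ p l' → l ≡ l')
      × (∀ r r' → SameSet (h r) (h r') → r ≡ r')
      × (∀ r r' → 0# ≤ dot (normal (h r)) (normal (h r')))
      × (∀ l r → E l r ⇔ (p l ∈ₕ h r))

{-# OPTIONS --safe #-}
module Submission where

-- Changing the signs of some coordinates is an isometry of the inner product,
-- so it carries G(P,H) to an isomorphic incidence graph. Colour each halfspace
-- by the sign pattern of its normal vector (2^d colours). Reflecting a colour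
-- class by its own sign pattern moves all its normals into the nonnegative
-- orthant, where inner products are nonnegative.

open import Defs
open import Level using (Level)
open import Data.Nat using (ℕ; _^_; zero) renaming (suc to sucℕ)
open import Data.Fin using (Fin; funToFin; finToFun) renaming (zero to fz; suc to fs)
open import Data.Fin.Properties using (finToFun-funToFin; _≟_)
open import Axiom.UniquenessOfIdentityProofs using (module Decidable⇒UIP)
open import Data.Product using (Σ; _,_; proj₁)
open import Data.Sum using (inj₁; inj₂)
open import Function.Base using (_∘_)
open import Function.Bundles using (_⇔_; mk⇔; Equivalence)
open import Relation.Binary.PropositionalEquality as ≡ using (_≡_)
open import Relation.Binary.Structures using (IsTotalOrder)
import Algebra.Properties.Ring as RingProperties

fibre-proj₁-injective : {a : Level} {J : Set a} {n : ℕ} (f : J → Fin n) {k : Fin n}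
  {x y : Σ J λ j → f j ≡ k} → proj₁ x ≡ proj₁ y → x ≡ y
fibre-proj₁-injective f {x = j , e} {y = .j , e′} ≡.refl =
  ≡.cong (j ,_) (Decidable⇒UIP.≡-irrelevant _≟_ e e′)

module Orthants {c ℓ₁ ℓ₂ : Level} (F : OrderedField c ℓ₁ ℓ₂) where
  open OrderedField F
  open Geometry F
  open IsTotalOrder isTotalOrder using (total; ≤-respˡ-≈; ≤-respʳ-≈)
    renaming (refl to ≤-refl; trans to ≤-trans)
  open RingProperties ring using (-‿distribˡ-*; -‿distribʳ-*; -‿involutive; -‿injective; -0#≈0#)

  SignPattern : ℕ → Set
  SignPattern d = Fin d → Fin 2

  applySign : Fin 2 → Carrier → Carrier
  applySign fz     x = x
  applySign (fs _) x = - x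

  applySign-* : ∀ b x y → (applySign b x * applySign b y) ≈ (x * y)
  applySign-* fz     x y = refl
  applySign-* (fs _) x y = begin
    - x * - y      ≈⟨ -‿distribˡ-* x (- y) ⟨
    - (x * - y)    ≈⟨ -‿cong (-‿distribʳ-* x y) ⟨
    - - (x * y)    ≈⟨ -‿involutive (x * y) ⟩
    x * y          ∎
    where open import Relation.Binary.Reasoning.Setoid setoid

  applySign-injective : ∀ b {x y} → applySign b x ≈ applySign b y → x ≈ y
  applySign-injective fz     e = e
  applySign-injective (fs _) e = -‿injective e

  applySign-0# : ∀ b → applySign b 0# ≈ 0#
  applySign-0# fz     = refl
  applySign-0# (fs _) = -0#≈0#

  reflect : ∀ {d} → SignPattern d → Point d → Point d
  reflect s x i = applySign (s i) (x i)

  dot-reflect : ∀ {d} (s : SignPattern d) w x → dot (reflect s w) (reflect s x) ≈ dot w x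
  dot-reflect {zero}   s w x = refl
  dot-reflect {sucℕ d} s w x =
    +-cong (applySign-* (s fz) (w fz) (x fz)) (dot-reflect (s ∘ fs) (w ∘ fs) (x ∘ fs))

  reflect-injective : ∀ {d} (s : SignPattern d) {x y} → reflect s x ≈ᵖ reflect s y → x ≈ᵖ y
  reflect-injective s e i = applySign-injective (s i) (e i)

  reflectHalfspace : ∀ {d} → SignPattern d → Halfspace d → Halfspace d
  reflectHalfspace s h = record
    { normal    = reflect s (normal h)
    ; threshold = threshold h
    ; normal≠0  = λ e → normal≠0 h (reflect-injective s (λ i → trans (e i) (sym (applySign-0# (s i)))))
    }

  ∈-reflect : ∀ {d} (s : SignPattern d) x h → (x ∈ₕ h) ⇔ (reflect s x ∈ₕ reflectHalfspace s h)
  ∈-reflect s x h = mk⇔ (≤-respˡ-≈ (sym (dot-reflect s (normal h) x)))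
                        (≤-respˡ-≈ (dot-reflect s (normal h) x))

  SameSet-reflect⁻¹ : ∀ {d} (s : SignPattern d) {h h′} →
    SameSet (reflectHalfspace s h) (reflectHalfspace s h′) → SameSet h h′
  SameSet-reflect⁻¹ s {h} {h′} S x = mk⇔
    (from h′ ∘ Equivalence.to   (S (reflect s x)) ∘ to h)
    (from h  ∘ Equivalence.from (S (reflect s x)) ∘ to h′)
    where
    to : ∀ g → x ∈ₕ g → reflect s x ∈ₕ reflectHalfspace s g
    to g = Equivalence.to (∈-reflect s x g)
    from : ∀ g → reflect s x ∈ₕ reflectHalfspace s g → x ∈ₕ g
    from g = Equivalence.from (∈-reflect s x g)

  0≤+ : ∀ {x y} → 0# ≤ x → 0# ≤ y → 0# ≤ (x + y)
  0≤+ {x} {y} 0≤x 0≤y = ≤-trans 0≤y (≤-respˡ-≈ (+-identityˡ y) (+-mono-≤ y 0≤x))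

  0≤-‿ : ∀ {x} → x ≤ 0# → 0# ≤ (- x)
  0≤-‿ {x} x≤0 = ≤-respʳ-≈ (+-identityˡ (- x)) (≤-respˡ-≈ (-‿inverseʳ x) (+-mono-≤ (- x) x≤0))

  0≤dot : ∀ {d} (x y : Point d) → (∀ i → 0# ≤ x i) → (∀ i → 0# ≤ y i) → 0# ≤ dot x y
  0≤dot {zero}   x y 0≤x 0≤y = ≤-refl
  0≤dot {sucℕ d} x y 0≤x 0≤y =
    0≤+ (*-nonneg (0≤x fz) (0≤y fz)) (0≤dot (x ∘ fs) (y ∘ fs) (0≤x ∘ fs) (0≤y ∘ fs))

  signOf : Carrier → Fin 2
  signOf x with total 0# x
  ... | inj₁ _ = fz
  ... | inj₂ _ = fs fz

  0≤applySign-signOf : ∀ x → 0# ≤ applySign (signOf x) x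
  0≤applySign-signOf x with total 0# x
  ... | inj₁ 0≤x = 0≤x
  ... | inj₂ x≤0 = 0≤-‿ x≤0

  signPattern : ∀ {d} → Point d → SignPattern d
  signPattern w i = signOf (w i)

  isPositive-commonSignPattern : ∀ {d a b} {I : Set a} {R : Set b} (s : SignPattern d)
    (P : I → Point d) (H : R → Halfspace d) →
    (∀ i i′ → P i ≈ᵖ P i′ → i ≡ i′) →
    (∀ r r′ → SameSet (H r) (H r′) → r ≡ r′) →
    (∀ r i → s i ≡ signPattern (normal (H r)) i) →
    IsPositiveIncidenceGraph d I R (λ i r → P i ∈ₕ H r)
  isPositive-commonSignPattern s P H injP injH sameSign =
    reflect s ∘ P , reflectHalfspace s ∘ H ,
    (λ i i′ e → injP i i′ (reflect-injective s e)) ,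
    (λ r r′ S → injH r r′ (SameSet-reflect⁻¹ s {H r} {H r′} S)) ,
    (λ r r′ → 0≤dot _ _ (inOrthant r) (inOrthant r′)) ,
    (λ i r → ∈-reflect s (P i) (H r))
    where
    inOrthant : ∀ r i → 0# ≤ reflect s (normal (H r)) i
    inOrthant r i = ≡.subst (λ b → 0# ≤ applySign b (normal (H r) i))
                          (≡.sym (sameSign r i)) (0≤applySign-signOf (normal (H r) i))

proposition4p5 : {c ℓ₁ ℓ₂ : Level} (F : OrderedField c ℓ₁ ℓ₂) (d : ℕ)
    (I J : Set) (P : I → Geometry.Point F d) (H : J → Geometry.Halfspace F d) →
    (∀ i i' → Geometry._≈ᵖ_ F (P i) (P i') → i ≡ i') →
    (∀ j j' → Geometry.SameSet F (H j) (H j') → j ≡ j') →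
    Σ (J → Fin (2 ^ d)) λ part →
    ∀ (k : Fin (2 ^ d)) →
    Geometry.IsPositiveIncidenceGraph F d I (Σ J λ j → part j ≡ k)
    (λ i jp → Geometry._∈ₕ_ F (P i) (H (Σ.proj₁ jp)))
proposition4p5 F d I J P H injP injH = colour , λ k →
  isPositive-commonSignPattern (finToFun k) P (H ∘ proj₁) injP
    (λ r r′ S → fibre-proj₁-injective colour (injH _ _ S))
    (λ { (j , ≡.refl) i → finToFun-funToFin (signPattern (normal (H j))) i })
  where
  open Orthants F
  open Geometry F using (normal)

  colour : J → Fin (2 ^ d)
  colour j = funToFin (signPattern (normal (H j)))
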